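{- Let $\mathcal{S}$ be a finite left regular band of groups and $x,y\in E(\mathcal{S})$. Left multiplication by $y$ induces a group morphism $\lambda_{y,x}:G_x\to G_{yx}$, $\lambda_{y,x}(s)=ys$. If $x,x'\in E(\mathcal{S})$ have the same support (i.e. $x\sim x'$), then $\lambda_{x,x'}:G_{x'}\to G_x$ is an isomorphism with inverse $\lambda_{x',x}$.
   Context: For $s$ in a finite semigroup, $s^\omega$ is the unique idempotent positive power of $s$. A finite semigroup $\mathcal{S}$ is a left regular band of groups if $s^\omega s=s$ and $sts^\omega=st$ for all $s,t$. $E(\mathcal{S})$ is the set of idempotents; for $x\in E(\mathcal{S})$, $G_x=\{s\in\mathcal{S}:s^\omega=x\}$, a group with identity $x$. $s\sim t$ iff $s^\omega t=s$ and $t^\omega s=t$; the support of $x$ is its $\sim$-class. -}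

module Defs where

open import Level using (Level) renaming (suc to lsuc)
open import Data.Nat using (ℕ; zero; suc)
open import Data.Fin using (Fin)
open import Data.Product using (Σ; ∃; _×_; _,_)
open import Function.Bundles using (_↔_)
open import Relation.Binary.PropositionalEquality using (_≡_)

record FiniteSemigroup (a : Level) : Set (lsuc a) where
  infixl 7 _∙_
  field
    Carrier : Set a
    _∙_     : Carrier → Carrier → Carrier
    assoc   : ∀ x y z → (x ∙ y) ∙ z ≡ x ∙ (y ∙ z)
    finite  : ∃ λ n → Carrier ↔ Fin n

module _ {a : Level} (S : FiniteSemigroup a) where
  open FiniteSemigroup S

  -- positive powers: pow s k = s^(k+1)
  pow : Carrier → ℕ → Carrier
  pow s zero    = s
  pow s (suc k) = s ∙ pow s k

  IsIdempotent : Carrier → Set a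
  IsIdempotent e = e ∙ e ≡ e

  -- "s^ω ≡ e": e is the (unique) idempotent positive power of s
  IsOmega : Carrier → Carrier → Set a
  IsOmega s e = IsIdempotent e × ∃ λ k → pow s k ≡ e

  InG : Carrier → Carrier → Set a
  InG x s = IsOmega s x

  IsLRBG : Set a
  IsLRBG = ∀ s e → IsOmega s e → (e ∙ s ≡ s) × (∀ t → s ∙ t ∙ e ≡ s ∙ t)

  _∼_ : Carrier → Carrier → Set a
  s ∼ t = ∀ e f → IsOmega s e → IsOmega t f → (e ∙ t ≡ s) × (f ∙ s ≡ t)

module Submission where

-- The identity y t y = y t (the band axiom at s = y) lets y be pushed through
-- products: y (s t) = (y s)(y t) and (y s)^k = y s^k, so left multiplication by y
-- is a morphism G_x → G_(yx).  If x ∼ x′ then x x′ = x and x′ x = x′, so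
-- λ_(x,x′) lands in G_x, and x′ (x s) = (x′ x) s = x′ s = s for s ∈ G_(x′).

open import Defs
open import Level using (Level)
open import Data.Nat using (zero; suc)
open import Data.Product using (_×_; _,_; proj₁; proj₂)
open import Relation.Binary.PropositionalEquality
  using (_≡_; refl; cong; subst; module ≡-Reasoning)

module LeftRegularBandOfGroups {a : Level} (S : FiniteSemigroup a) (lrbg : IsLRBG S) where
  open FiniteSemigroup S
  open ≡-Reasoning

  idempotent⇒isOmega : ∀ {e} → IsIdempotent S e → IsOmega S e e
  idempotent⇒isOmega ie = ie , 0 , refl

  idempotent-absorbsʳ : ∀ {y} → IsIdempotent S y → ∀ t → y ∙ t ∙ y ≡ y ∙ t
  idempotent-absorbsʳ {y} iy = proj₂ (lrbg y y (idempotent⇒isOmega iy))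

  idempotent-distribˡ : ∀ {y} → IsIdempotent S y → ∀ s t → y ∙ (s ∙ t) ≡ (y ∙ s) ∙ (y ∙ t)
  idempotent-distribˡ {y} iy s t = begin
    y ∙ (s ∙ t)       ≡⟨ assoc y s t ⟨
    y ∙ s ∙ t         ≡⟨ cong (_∙ t) (idempotent-absorbsʳ iy s) ⟨
    y ∙ s ∙ y ∙ t     ≡⟨ assoc (y ∙ s) y t ⟩
    (y ∙ s) ∙ (y ∙ t) ∎

  pow-idempotent-∙ˡ : ∀ {y} → IsIdempotent S y → ∀ s k → pow S (y ∙ s) k ≡ y ∙ pow S s k
  pow-idempotent-∙ˡ iy s zero    = refl
  pow-idempotent-∙ˡ {y} iy s (suc k) = begin
    (y ∙ s) ∙ pow S (y ∙ s) k ≡⟨ cong ((y ∙ s) ∙_) (pow-idempotent-∙ˡ iy s k) ⟩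
    (y ∙ s) ∙ (y ∙ pow S s k) ≡⟨ idempotent-distribˡ iy s (pow S s k) ⟨
    y ∙ (s ∙ pow S s k)       ∎

  idempotent-∙-idempotent : ∀ {x y} → IsIdempotent S x → IsIdempotent S y →
                            IsIdempotent S (y ∙ x)
  idempotent-∙-idempotent {x} {y} ix iy = begin
    (y ∙ x) ∙ (y ∙ x) ≡⟨ idempotent-distribˡ iy x x ⟨
    y ∙ (x ∙ x)       ≡⟨ cong (y ∙_) ix ⟩
    y ∙ x             ∎

  ∙ˡ-preserves-InG : ∀ {x y} → IsIdempotent S x → IsIdempotent S y →
                     ∀ s → InG S x s → InG S (y ∙ x) (y ∙ s)
  ∙ˡ-preserves-InG {x} {y} ix iy s (_ , k , sᵏ≡x) =
    idempotent-∙-idempotent ix iy , k , (begin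
      pow S (y ∙ s) k ≡⟨ pow-idempotent-∙ˡ iy s k ⟩
      y ∙ pow S s k   ≡⟨ cong (y ∙_) sᵏ≡x ⟩
      y ∙ x           ∎)

  ∼-idempotent : ∀ {x x′} → IsIdempotent S x → IsIdempotent S x′ → _∼_ S x x′ →
                 (x ∙ x′ ≡ x) × (x′ ∙ x ≡ x′)
  ∼-idempotent ix ix′ x∼x′ = x∼x′ _ _ (idempotent⇒isOmega ix) (idempotent⇒isOmega ix′)

  ∙ˡ-inverseˡ : ∀ {x x′} → IsIdempotent S x → IsIdempotent S x′ →
                x ∙ x′ ≡ x → x′ ∙ x ≡ x′ →
                ∀ s → InG S x′ s → InG S x (x ∙ s) × x′ ∙ (x ∙ s) ≡ s
  ∙ˡ-inverseˡ {x} {x′} ix ix′ xx′≡x x′x≡x′ s s∈Gx′ =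
    subst (λ z → InG S z (x ∙ s)) xx′≡x (∙ˡ-preserves-InG ix′ ix s s∈Gx′) , (begin
      x′ ∙ (x ∙ s) ≡⟨ assoc x′ x s ⟨
      x′ ∙ x ∙ s   ≡⟨ cong (_∙ s) x′x≡x′ ⟩
      x′ ∙ s       ≡⟨ proj₁ (lrbg s x′ s∈Gx′) ⟩
      s            ∎)

proposition3p12 : ∀ {a : Level} (S : FiniteSemigroup a) → IsLRBG S →
    let open FiniteSemigroup S in
    (∀ x y → IsIdempotent S x → IsIdempotent S y →
       (∀ s → InG S x s → InG S (y ∙ x) (y ∙ s))
       × (∀ s t → InG S x s → InG S x t → y ∙ (s ∙ t) ≡ (y ∙ s) ∙ (y ∙ t)))
    × (∀ x x′ → IsIdempotent S x → IsIdempotent S x′ → _∼_ S x x′ →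
       (∀ s → InG S x′ s → InG S x (x ∙ s) × x′ ∙ (x ∙ s) ≡ s)
       × (∀ s → InG S x s → InG S x′ (x′ ∙ s) × x ∙ (x′ ∙ s) ≡ s))
proposition3p12 S lrbg =
  (λ x y ix iy → ∙ˡ-preserves-InG ix iy , λ s t _ _ → idempotent-distribˡ iy s t)
  , λ x x′ ix ix′ x∼x′ →
      let (xx′≡x , x′x≡x′) = ∼-idempotent ix ix′ x∼x′ in
      ∙ˡ-inverseˡ ix ix′ xx′≡x x′x≡x′ , ∙ˡ-inverseˡ ix′ ix x′x≡x′ xx′≡x
  where open LeftRegularBandOfGroups S lrbg
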